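{- Let $R$ be a discrete valuation ring with uniformizing parameter $t$, let $\mu=(\mu_1\ge\dots\ge\mu_r\ge0)$ be a partition, and let $Q$ be an $r\times r$ $\mu$-admissible matrix. Let $I=(i_1<\dots<i_k)$ and $H=(h_1<\dots<h_k)$ be index sets of length $k\le r$, and define $Min(I,H)=(m_1,\dots,m_k)$ with $m_s=\min\{i_s,h_s\}$. Then $$|\mu_{Min(I,H)}|-|\mu_I|\le\|Q_{IH}\|.$$
   Context: For $0\ne a\in R$ write $a=ut^k$ with $u$ a unit and $k\ge0$, and set $\|a\|=k$; for a square matrix $B$, $\|B\|=\|\det B\|$ (with $\|0\|=+\infty$). $D_\mu=\mathrm{diag}(t^{\mu_1},\dots,t^{\mu_r})$; a matrix $Q\in GL_r(R)$ is $\mu$-admissible if $D_\mu QD_\mu^{ -1}\in GL_r(R)$. $Q_{IH}$ is the determinant of the submatrix of $Q$ with rows $I$ and columns $H$. For an index tuple $A=(a_1,\dots,a_k)$, $|\mu_A|=\mu_{a_1}+\dots+\mu_{a_k}$. -}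

module Defs where

open import Level using (_⊔_) renaming (suc to lsuc)
open import Algebra.Bundles using (CommutativeRing)
open import Data.Nat as ℕ using (ℕ; zero; suc)
open import Data.Fin as Fin using (Fin; zero; suc; punchIn; toℕ)
open import Data.Product using (Σ; ∃; _×_; _,_)
open import Relation.Nullary using (¬_)
import Data.Sum

minFin : ∀ {r} → Fin r → Fin r → Fin r
minFin i h with toℕ i ℕ.≤? toℕ h
... | Relation.Nullary.yes _ = i
... | Relation.Nullary.no _ = h

sumℕ : ∀ {k} → (Fin k → ℕ) → ℕ
sumℕ {zero} f = 0
sumℕ {suc k} f = f zero ℕ.+ sumℕ (λ s → f (suc s))

∣_at_∣ : ∀ {r k} → (Fin r → ℕ) → (Fin k → Fin r) → ℕ
∣ μ at A ∣ = sumℕ (λ s → μ (A s))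

MinIdx : ∀ {r k} → (Fin k → Fin r) → (Fin k → Fin r) → Fin k → Fin r
MinIdx I H s = minFin (I s) (H s)

StrictlyIncreasing : ∀ {r k} → (Fin k → Fin r) → Set
StrictlyIncreasing {k = k} I = ∀ (a b : Fin k) → a Fin.< b → I a Fin.< I b

IsPartition : ∀ {r} → (Fin r → ℕ) → Set
IsPartition {r} μ = ∀ (i j : Fin r) → i Fin.≤ j → μ j ℕ.≤ μ i

module RingDefs {c ℓ} (R : CommutativeRing c ℓ) where
  open CommutativeRing R hiding (zero)

  Matrix : ℕ → Set c
  Matrix n = Fin n → Fin n → Carrier

  _^_ : Carrier → ℕ → Carrier
  x ^ zero = 1#
  x ^ suc n = x * (x ^ n)

  IsUnit : Carrier → Set (c ⊔ ℓ)
  IsUnit u = Σ Carrier λ v → u * v ≈ 1#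

  altSum : ∀ {m} → (Fin m → Carrier) → Carrier
  altSum {zero} f = 0#
  altSum {suc m} f = f zero - altSum (λ j → f (suc j))

  det : ∀ {n} → Matrix n → Carrier
  det {zero} M = 1#
  det {suc n} M = altSum (λ j → M zero j * det (λ a b → M (suc a) (punchIn j b)))

  sumR : ∀ {m} → (Fin m → Carrier) → Carrier
  sumR {zero} f = 0#
  sumR {suc m} f = f zero + sumR (λ j → f (suc j))

  _⊗_ : ∀ {n} → Matrix n → Matrix n → Matrix n
  (A ⊗ B) i j = sumR (λ l → A i l * B l j)

  idM : ∀ {n} → Matrix n
  idM i j with i Fin.≟ j
  ... | Relation.Nullary.yes _ = 1#
  ... | Relation.Nullary.no _ = 0#

  InGL : ∀ {n} → Matrix n → Set (c ⊔ ℓ)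
  InGL {n} Q = Σ (Matrix n) λ Q' → (∀ i j → (Q ⊗ Q') i j ≈ idM i j) × (∀ i j → (Q' ⊗ Q) i j ≈ idM i j)

  minor : ∀ {r k} → Matrix r → (Fin k → Fin r) → (Fin k → Fin r) → Carrier
  minor Q I H = det (λ a b → Q (I a) (H b))

record DVR c ℓ : Set (lsuc (c ⊔ ℓ)) where
  field
    commRing : CommutativeRing c ℓ
  open CommutativeRing commRing public hiding (zero)
  open RingDefs commRing public
  field
    1≉0 : ¬ (1# ≈ 0#)
    noZeroDivisors : ∀ a b → a * b ≈ 0# → (a ≈ 0#) Data.Sum.⊎ (b ≈ 0#)
    t : Carrier
    t≉0 : ¬ (t ≈ 0#)
    t-nonunit : ¬ IsUnit t
    factor : ∀ a → ¬ (a ≈ 0#) → Σ Carrier λ u → Σ ℕ λ k → IsUnit u × (a ≈ u * (t ^ k))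

  -- ‖a‖ = k : a = u t^k with u a unit (k is unique; no such k exists for a = 0,
  -- matching ‖0‖ = +∞)
  HasNorm : Carrier → ℕ → Set (c ⊔ ℓ)
  HasNorm a k = Σ Carrier λ u → IsUnit u × (a ≈ u * (t ^ k))

  -- Q is μ-admissible: Q ∈ GL_r(R) and D_μ Q D_μ^{-1} ∈ GL_r(R), i.e. there is
  -- P ∈ GL_r(R) with P_{ij} = t^{μ_i} Q_{ij} t^{-μ_j}, i.e. P_{ij} t^{μ_j} = t^{μ_i} Q_{ij}.
  Admissible : ∀ {r} → (Fin r → ℕ) → Matrix r → Set (c ⊔ ℓ)
  Admissible {r} μ Q = InGL Q × Σ (Matrix r) λ P → InGL P ×
    (∀ i j → P i j * (t ^ μ j) ≈ (t ^ μ i) * Q i j)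

-- Multiplying row s of the minor by t^{μ_{i_s}} turns Q_{IH} into t^{|μ_I|} Q_{IH}.
-- The (s,u) entry of the scaled matrix, t^{μ_{i_s}} Q_{i_s h_u}, equals P_{i_s h_u} t^{μ_{h_u}}
-- by admissibility, so it is divisible by t^{max(μ_{i_s}, μ_{h_u})}. Since μ∘I and μ∘H are both
-- nonincreasing, the diagonal pairing minimises the sum of these exponents, so every term of the
-- determinant is divisible by t^{Σ_s max(μ_{i_s}, μ_{h_s})} = t^{|μ_{Min(I,H)}|}. Cancelling
-- t^{|μ_I|} in the domain R leaves t^{|μ_{Min(I,H)}| - |μ_I|} ∣ Q_{IH}, and a power of t dividing
-- u t^n with u a unit is at most t^n.
module Submission where

open import Defs
open import Data.Nat using (ℕ)
open import Data.Fin using (Fin)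
open import Data.Integer using (+_; _-_; _≤_)

open import Algebra.Bundles using (CommutativeRing)
import Algebra.Definitions.RawMagma as RawMagmaDefs
import Algebra.Properties.CommutativeSemigroup as CommSemigroupProps
import Algebra.Properties.CommutativeSemigroup.Divisibility as CommSemigroupDivisibility
import Algebra.Properties.Ring as RingProps
import Algebra.Properties.Semiring.Divisibility as SemiringDivisibility
open import Data.Empty using (⊥-elim)
open import Data.Fin as Fin using (zero; suc; punchIn)
import Data.Fin.Properties as Finₚ
import Data.Integer as ℤ
import Data.Integer.Properties as ℤₚ
open import Data.Nat as ℕ using (_⊔_; _∸_; z≤n; s≤s)
import Data.Nat.Properties as ℕₚ
open import Data.Product using (_,_)
open import Data.Sum using (inj₁; inj₂)
open import Relation.Binary.PropositionalEquality as ≡ using (_≡_)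
import Relation.Binary.Reasoning.Setoid as SetoidReasoning
open import Relation.Nullary using (¬_; yes; no)

Nonincreasing : ∀ {k} → (Fin k → ℕ) → Set
Nonincreasing a = ∀ {s s'} → s Fin.≤ s' → a s' ℕ.≤ a s

Nonincreasing-tail : ∀ {k} {a : Fin (ℕ.suc k) → ℕ} → Nonincreasing a → Nonincreasing (λ s → a (suc s))
Nonincreasing-tail a↓ s≤s' = a↓ (s≤s s≤s')

Nonincreasing-punchIn : ∀ {k} {b : Fin (ℕ.suc k) → ℕ} j → Nonincreasing b → Nonincreasing (λ s → b (punchIn j s))
Nonincreasing-punchIn j b↓ {s} {s'} s≤s' = b↓ (Finₚ.punchIn-mono-≤ j s s' s≤s')

sumℕ-mono-≤ : ∀ {k} {f g : Fin k → ℕ} → (∀ s → f s ℕ.≤ g s) → sumℕ f ℕ.≤ sumℕ g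
sumℕ-mono-≤ {ℕ.zero}  f≤g = z≤n
sumℕ-mono-≤ {ℕ.suc k} f≤g = ℕₚ.+-mono-≤ (f≤g zero) (sumℕ-mono-≤ (λ s → f≤g (suc s)))

sumℕ-cong : ∀ {k} {f g : Fin k → ℕ} → (∀ s → f s ≡ g s) → sumℕ f ≡ sumℕ g
sumℕ-cong {ℕ.zero}  f≡g = ≡.refl
sumℕ-cong {ℕ.suc k} f≡g = ≡.cong₂ ℕ._+_ (f≡g zero) (sumℕ-cong (λ s → f≡g (suc s)))

sumℕ-≤-sumℕ-⊔ : ∀ {k} (f g : Fin k → ℕ) → sumℕ f ℕ.≤ sumℕ (λ s → f s ⊔ g s)
sumℕ-≤-sumℕ-⊔ f g = sumℕ-mono-≤ (λ s → ℕₚ.m≤m⊔n (f s) (g s))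

-- Rearrangement for two similarly ordered pairs: matching the large with the large
-- minimises the sum of maxima.
⊔-+-⊔-exchange : ∀ {x y p q} → y ℕ.≤ x → q ℕ.≤ p → (x ⊔ p) ℕ.+ (y ⊔ q) ℕ.≤ (x ⊔ q) ℕ.+ (y ⊔ p)
⊔-+-⊔-exchange {x} {y} {p} {q} y≤x q≤p with ℕₚ.≤-total p x
... | inj₁ p≤x rewrite ℕₚ.m≥n⇒m⊔n≡m p≤x =
  ℕₚ.+-mono-≤ (ℕₚ.m≤m⊔n x q) (ℕₚ.⊔-monoʳ-≤ y q≤p)
... | inj₂ x≤p rewrite ℕₚ.m≤n⇒m⊔n≡n x≤p | ℕₚ.m≤n⇒m⊔n≡n (ℕₚ.≤-trans y≤x x≤p) =
  ℕₚ.≤-trans (ℕₚ.+-monoʳ-≤ p (ℕₚ.⊔-monoˡ-≤ q y≤x)) (ℕₚ.≤-reflexive (ℕₚ.+-comm p (x ⊔ q)))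

-- Among the terms of a first-row expansion, the diagonal pairing s ↦ s has the least sum of maxima.
sum⊔-≤-punchIn : ∀ {k} {a b : Fin (ℕ.suc k) → ℕ} → Nonincreasing a → Nonincreasing b → ∀ j →
  sumℕ (λ s → a s ⊔ b s) ℕ.≤ (a zero ⊔ b j) ℕ.+ sumℕ (λ s → a (suc s) ⊔ b (punchIn j s))
sum⊔-≤-punchIn a↓ b↓ zero = ℕₚ.≤-refl
sum⊔-≤-punchIn {ℕ.suc k} {a} {b} a↓ b↓ (suc j) = begin
  p ℕ.+ sumℕ (λ s → a (suc s) ⊔ b (suc s))
                       ≤⟨ ℕₚ.+-monoʳ-≤ p (sum⊔-≤-punchIn (Nonincreasing-tail a↓) (Nonincreasing-tail b↓) j) ⟩
  p ℕ.+ (q' ℕ.+ rest)  ≡⟨ ℕₚ.+-assoc p q' rest ⟨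
  p ℕ.+ q' ℕ.+ rest    ≤⟨ ℕₚ.+-monoˡ-≤ rest (⊔-+-⊔-exchange (a↓ z≤n) (b↓ z≤n)) ⟩
  p' ℕ.+ q ℕ.+ rest    ≡⟨ ℕₚ.+-assoc p' q rest ⟩
  p' ℕ.+ (q ℕ.+ rest)  ∎
  where
  open ℕₚ.≤-Reasoning
  p p' q q' rest : ℕ
  p    = a zero ⊔ b zero
  p'   = a zero ⊔ b (suc j)
  q    = a (suc zero) ⊔ b zero
  q'   = a (suc zero) ⊔ b (suc j)
  rest = sumℕ (λ s → a (suc (suc s)) ⊔ b (suc (punchIn j s)))

module PowerDivisibility {c ℓ} (R : CommutativeRing c ℓ) where
  open CommutativeRing R hiding (zero)
  open RingDefs R
  open RawMagmaDefs *-rawMagma using (_∣_; _,_)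
  open SemiringDivisibility semiring using (_∣0; ∣ʳ-trans)
  open CommSemigroupDivisibility *-commutativeSemigroup using (∙-cong-∣; ∣-respˡ-≈)
  open RingProps ring using (-‿distribˡ-*; x[y-z]≈xy-xz)
  open CommSemigroupProps *-commutativeSemigroup using (interchange)
  open SetoidReasoning setoid

  ^-congʳ : ∀ x {m n} → m ≡ n → x ^ m ≈ x ^ n
  ^-congʳ x m≡n = reflexive (≡.cong (x ^_) m≡n)

  ^-homo-* : ∀ x m n → x ^ (m ℕ.+ n) ≈ x ^ m * x ^ n
  ^-homo-* x ℕ.zero    n = sym (*-identityˡ _)
  ^-homo-* x (ℕ.suc m) n = trans (*-congˡ (^-homo-* x m n)) (sym (*-assoc _ _ _))

  ∣-+ : ∀ {x a b} → x ∣ a → x ∣ b → x ∣ a + b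
  ∣-+ {x} (p , px≈a) (q , qx≈b) = p + q , trans (distribʳ x p q) (+-cong px≈a qx≈b)

  ∣-‿ : ∀ {x a} → x ∣ a → x ∣ - a
  ∣-‿ {x} (p , px≈a) = - p , trans (sym (-‿distribˡ-* p x)) (-‿cong px≈a)

  ∣-altSum : ∀ {k x} {f : Fin k → Carrier} → (∀ j → x ∣ f j) → x ∣ altSum f
  ∣-altSum {ℕ.zero}  {x} x∣f = x ∣0
  ∣-altSum {ℕ.suc k}     x∣f = ∣-+ (x∣f zero) (∣-‿ (∣-altSum (λ j → x∣f (suc j))))

  ^-∣-mono : ∀ x {m n} → m ℕ.≤ n → x ^ m ∣ x ^ n
  ^-∣-mono x {m} {n} m≤n = x ^ (n ∸ m) , trans (sym (^-homo-* x (n ∸ m) m)) (^-congʳ x (ℕₚ.m∸n+n≡m m≤n))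

  ^-⊔-∣ : ∀ x {m n a} → x ^ m ∣ a → x ^ n ∣ a → x ^ (m ⊔ n) ∣ a
  ^-⊔-∣ x {m} {n} xᵐ∣a xⁿ∣a with ℕₚ.⊔-sel m n
  ... | inj₁ m⊔n≡m = ∣-respˡ-≈ (^-congʳ x (≡.sym m⊔n≡m)) xᵐ∣a
  ... | inj₂ m⊔n≡n = ∣-respˡ-≈ (^-congʳ x (≡.sym m⊔n≡n)) xⁿ∣a

  altSum-cong : ∀ {k} {f g : Fin k → Carrier} → (∀ j → f j ≈ g j) → altSum f ≈ altSum g
  altSum-cong {ℕ.zero}  f≈g = refl
  altSum-cong {ℕ.suc k} f≈g = +-cong (f≈g zero) (-‿cong (altSum-cong (λ j → f≈g (suc j))))

  altSum-*ˡ : ∀ {k} x (f : Fin k → Carrier) → altSum (λ j → x * f j) ≈ x * altSum f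
  altSum-*ˡ {ℕ.zero}  x f = sym (zeroʳ x)
  altSum-*ˡ {ℕ.suc k} x f = begin
    x * f zero + - altSum (λ j → x * f (suc j))  ≈⟨ +-congˡ (-‿cong (altSum-*ˡ x (λ j → f (suc j)))) ⟩
    x * f zero + - (x * altSum (λ j → f (suc j))) ≈⟨ x[y-z]≈xy-xz x _ _ ⟨
    x * altSum f                               ∎

  det-scaleRows : ∀ {k} x (g : Fin k → ℕ) (M : Matrix k) →
    det (λ s u → x ^ g s * M s u) ≈ x ^ sumℕ g * det M
  det-scaleRows {ℕ.zero}  x g M = sym (*-identityˡ _)
  det-scaleRows {ℕ.suc k} x g M = trans (altSum-cong term) (altSum-*ˡ (x ^ sumℕ g) (λ j → M zero j * det (minorAt j)))
    where
    g₀ G : Carrier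
    g₀ = x ^ g zero
    G  = x ^ sumℕ (λ s → g (suc s))
    minorAt : Fin (ℕ.suc k) → Matrix k
    minorAt j s u = M (suc s) (punchIn j u)
    term : ∀ j → g₀ * M zero j * det (λ s u → x ^ g (suc s) * minorAt j s u)
               ≈ x ^ sumℕ g * (M zero j * det (minorAt j))
    term j = begin
      g₀ * M zero j * det (λ s u → x ^ g (suc s) * minorAt j s u)
        ≈⟨ *-congˡ (det-scaleRows x (λ s → g (suc s)) (minorAt j)) ⟩
      g₀ * M zero j * (G * det (minorAt j))  ≈⟨ interchange _ _ _ _ ⟩
      g₀ * G * (M zero j * det (minorAt j))  ≈⟨ *-congʳ (^-homo-* x (g zero) _) ⟨
      x ^ sumℕ g * (M zero j * det (minorAt j)) ∎

  det-divisible : ∀ {k} x {a b : Fin k → ℕ} → Nonincreasing a → Nonincreasing b → (M : Matrix k) →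
    (∀ s u → x ^ (a s ⊔ b u) ∣ M s u) → x ^ sumℕ (λ s → a s ⊔ b s) ∣ det M
  det-divisible {ℕ.zero}  x a↓ b↓ M x∣M = 1# , *-identityˡ 1#
  det-divisible {ℕ.suc k} x {a} {b} a↓ b↓ M x∣M = ∣-altSum λ j →
    ∣ʳ-trans (^-∣-mono x (sum⊔-≤-punchIn a↓ b↓ j))
      (∣-respˡ-≈ (sym (^-homo-* x (a zero ⊔ b j) _))
        (∙-cong-∣ (x∣M zero j)
          (det-divisible x (Nonincreasing-tail a↓) (Nonincreasing-punchIn j b↓) _
            (λ s u → x∣M (suc s) (punchIn j u)))))

module _ {c ℓ} (R : DVR c ℓ) where
  open DVR R
  open PowerDivisibility commRing
  open RawMagmaDefs *-rawMagma using (_∣_; _,_)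
  open SemiringDivisibility semiring using (∣ʳ-trans)
  open CommSemigroupDivisibility *-commutativeSemigroup using (x∣xy; ∣-respˡ-≈; ∣-respʳ-≈)
  open CommSemigroupProps *-commutativeSemigroup using (x∙yz≈y∙xz)
  open RingProps ring using (x[y-z]≈xy-xz; x∙y⁻¹≈ε⇒x≈y)
  open SetoidReasoning setoid

  ^-≉0 : ∀ {x} k → ¬ (x ≈ 0#) → ¬ (x ^ k ≈ 0#)
  ^-≉0 ℕ.zero    x≉0 1≈0 = 1≉0 1≈0
  ^-≉0 {x} (ℕ.suc k) x≉0 xxᵏ≈0 with noZeroDivisors x (x ^ k) xxᵏ≈0
  ... | inj₁ x≈0  = x≉0 x≈0
  ... | inj₂ xᵏ≈0 = ^-≉0 k x≉0 xᵏ≈0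

  *-cancelˡ : ∀ {x a b} → ¬ (x ≈ 0#) → x * a ≈ x * b → a ≈ b
  *-cancelˡ {x} {a} {b} x≉0 xa≈xb
    with noZeroDivisors x (a + - b) (trans (x[y-z]≈xy-xz x a b) (trans (+-congʳ xa≈xb) (-‿inverseʳ (x * b))))
  ... | inj₁ x≈0   = ⊥-elim (x≉0 x≈0)
  ... | inj₂ a-b≈0 = x∙y⁻¹≈ε⇒x≈y a b a-b≈0

  ∣-cancelˡ : ∀ {x a b} → ¬ (x ≈ 0#) → x * a ∣ x * b → a ∣ b
  ∣-cancelˡ {x} {a} {b} x≉0 (q , q[xa]≈xb) = q , *-cancelˡ x≉0 (trans (sym (x∙yz≈y∙xz q x a)) q[xa]≈xb)

  t∤unit : ∀ {u} → IsUnit u → ¬ (t ∣ u)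
  t∤unit {u} (v , uv≈1) (q , qt≈u) = t-nonunit (q * v , (begin
    t * (q * v)  ≈⟨ x∙yz≈y∙xz t q v ⟩
    q * (t * v)  ≈⟨ *-assoc q t v ⟨
    q * t * v    ≈⟨ *-congʳ qt≈u ⟩
    u * v        ≈⟨ uv≈1 ⟩
    1#           ∎))

  ^∣⇒≤-norm : ∀ {a n d} → HasNorm a n → t ^ d ∣ a → d ℕ.≤ n
  ^∣⇒≤-norm {a} {n} {d} (u , u-unit , a≈utⁿ) tᵈ∣a with d ℕ.≤? n
  ... | yes d≤n = d≤n
  ... | no  d≰n = ⊥-elim (t∤unit u-unit (∣-cancelˡ (^-≉0 n t≉0) tⁿt∣tⁿu))
    where
    tⁿt∣tⁿu : t ^ n * t ∣ t ^ n * u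
    tⁿt∣tⁿu = ∣-respˡ-≈ (*-comm t (t ^ n)) (∣-respʳ-≈ (trans a≈utⁿ (*-comm u (t ^ n)))
                (∣ʳ-trans (^-∣-mono t (ℕₚ.≰⇒> d≰n)) tᵈ∣a))

  admissible-entry-∣ : ∀ {r} (μ : Fin r → ℕ) {Q : Matrix r} → Admissible μ Q →
    ∀ i j → t ^ (μ i ⊔ μ j) ∣ t ^ μ i * Q i j
  admissible-entry-∣ μ {Q} (_ , P , _ , PD≈DQ) i j = ^-⊔-∣ t {μ i} {μ j} (x∣xy _ (Q i j)) (P i j , PD≈DQ i j)

  minor-divisible : ∀ {r} (μ : Fin r → ℕ) {Q : Matrix r} → Admissible μ Q →
    ∀ {k} (I H : Fin k → Fin r) → Nonincreasing (λ s → μ (I s)) → Nonincreasing (λ s → μ (H s)) →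
    t ^ (sumℕ (λ s → μ (I s) ⊔ μ (H s)) ∸ ∣ μ at I ∣) ∣ minor Q I H
  minor-divisible μ {Q} adm I H μI↓ μH↓ =
    ∣-cancelˡ (^-≉0 A t≉0)
      (∣-respˡ-≈ tˢ≈tᴬtˢ⁻ᴬ
        (∣-respʳ-≈ (det-scaleRows t (λ s → μ (I s)) (λ s u → Q (I s) (H u)))
          (det-divisible t μI↓ μH↓ _ (λ s u → admissible-entry-∣ μ adm (I s) (H u)))))
    where
    A S : ℕ
    A = ∣ μ at I ∣
    S = sumℕ (λ s → μ (I s) ⊔ μ (H s))
    tˢ≈tᴬtˢ⁻ᴬ : t ^ S ≈ t ^ A * t ^ (S ∸ A)
    tˢ≈tᴬtˢ⁻ᴬ = trans (^-congʳ t (≡.sym (ℕₚ.m+[n∸m]≡n (sumℕ-≤-sumℕ-⊔ (λ s → μ (I s)) (λ s → μ (H s))))))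
                      (^-homo-* t A (S ∸ A))

Partition-∘-StrictlyIncreasing : ∀ {r k} {μ : Fin r → ℕ} {I : Fin k → Fin r} →
  IsPartition μ → StrictlyIncreasing I → Nonincreasing (λ s → μ (I s))
Partition-∘-StrictlyIncreasing {I = I} μ↓ I↑ {s} {s'} s≤s' with s Finₚ.≟ s'
... | yes ≡.refl = ℕₚ.≤-refl
... | no  s≢s'   = μ↓ (I s) (I s') (ℕₚ.<⇒≤ (I↑ s s' (Finₚ.≤∧≢⇒< s≤s' s≢s')))

Partition-minFin : ∀ {r} {μ : Fin r → ℕ} → IsPartition μ → ∀ i h → μ (minFin i h) ≡ μ i ⊔ μ h
Partition-minFin μ↓ i h with Fin.toℕ i ℕ.≤? Fin.toℕ h
... | yes i≤h = ≡.sym (ℕₚ.m≥n⇒m⊔n≡m (μ↓ i h i≤h))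
... | no  i≰h = ≡.sym (ℕₚ.m≤n⇒m⊔n≡n (μ↓ h i (ℕₚ.≰⇒≥ i≰h)))

mainTheorem5 : ∀ {c ℓ} (R : DVR c ℓ) (r : ℕ) (μ : Fin r → ℕ) (Q : DVR.Matrix R r)
    → IsPartition μ → DVR.Admissible R μ Q
    → (k : ℕ) (I H : Fin k → Fin r) → StrictlyIncreasing I → StrictlyIncreasing H
    → (n : ℕ) → DVR.HasNorm R (DVR.minor R Q I H) n
    → (+ ∣ μ at MinIdx I H ∣) - (+ ∣ μ at I ∣) ≤ + n
mainTheorem5 R r μ Q μ↓ adm k I H I↑ H↑ n ‖Q_IH‖≡n = begin
  + ∣ μ at MinIdx I H ∣ - + A  ≡⟨ ≡.cong (λ m → + m - + A) (sumℕ-cong (λ s → Partition-minFin μ↓ (I s) (H s))) ⟩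
  + S - + A                    ≡⟨ ℤₚ.[+m]-[+n]≡m⊖n S A ⟩
  S ℤ.⊖ A                      ≡⟨ ℤₚ.⊖-≥ (sumℕ-≤-sumℕ-⊔ (λ s → μ (I s)) (λ s → μ (H s))) ⟩
  + (S ∸ A)                    ≤⟨ ℤ.+≤+ (^∣⇒≤-norm R ‖Q_IH‖≡n (minor-divisible R μ adm I H μI↓ μH↓)) ⟩
  + n                          ∎
  where
  open ℤₚ.≤-Reasoning
  A S : ℕ
  A = ∣ μ at I ∣
  S = sumℕ (λ s → μ (I s) ⊔ μ (H s))
  μI↓ : Nonincreasing (λ s → μ (I s))
  μI↓ = Partition-∘-StrictlyIncreasing μ↓ I↑
  μH↓ : Nonincreasing (λ s → μ (H s))
  μH↓ = Partition-∘-StrictlyIncreasing μ↓ H↑
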